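{- Let $G$ be a complete $k$-partite graph. Then $\rho_T(G)\le k$.
   Context: Graphs are finite and simple. A complete $k$-partite graph is one whose vertex set is partitioned into $k$ independent sets (partite sets) such that two vertices are adjacent iff they lie in different partite sets. For $u,v\in(\mathbb{R}\cup\{\infty\})^m$, $u\odot v=\min_i(u_i+v_i)$. $\rho_T(G)$ is the minimum $m$ such that there is $f:V(G)\to(\mathbb{R}\cup\{\infty\})^m$ and a threshold $t>0$ with, for all distinct $x,y$, $xy\in E(G)$ iff $f(x)\odot f(y)\ge t$. -}

module Defs where

open import Level using (Level; suc; _⊔_)
open import Data.Nat using (ℕ)
open import Data.Fin using (Fin)
open import Data.Vec using (Vec; []; _∷_)
open import Data.Unit using (⊤)
open import Data.Rational as ℚ using (ℚ)
open import Relation.Nullary using (¬_)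
open import Relation.Binary.PropositionalEquality using (_≡_)
open import Function.Bundles using (_⇔_)
open import Data.Product using (∃; _×_)

record SimpleGraph (n : ℕ) : Set₁ where
  field
    Adj    : Fin n → Fin n → Set
    sym    : ∀ {x y} → Adj x y → Adj y x
    irrefl : ∀ {x} → ¬ Adj x x
open SimpleGraph public

-- G is complete k-partite: there is an assignment of vertices to k partite
-- sets (some possibly empty) such that x,y are adjacent iff they lie in
-- different partite sets.
IsCompleteMultipartite : ∀ {n} → ℕ → SimpleGraph n → Set
IsCompleteMultipartite {n} k G =
  ∃ λ (p : Fin n → Fin k) → ∀ x y → Adj G x y ⇔ (¬ p x ≡ p y)

data ℚ∞ : Set where
  fin : ℚ → ℚ∞
  ∞   : ℚ∞

_+∞_ : ℚ∞ → ℚ∞ → ℚ∞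
fin a +∞ fin b = fin (a ℚ.+ b)
fin a +∞ ∞     = ∞
∞     +∞ _     = ∞

_⊓∞_ : ℚ∞ → ℚ∞ → ℚ∞
fin a ⊓∞ fin b = fin (a ℚ.⊓ b)
fin a ⊓∞ ∞     = fin a
∞     ⊓∞ y     = y

_⊙_ : ∀ {m} → Vec ℚ∞ m → Vec ℚ∞ m → ℚ∞
[]       ⊙ []       = ∞
(a ∷ u) ⊙ (b ∷ v) = (a +∞ b) ⊓∞ (u ⊙ v)

_≥∞_ : ℚ∞ → ℚ → Set
fin a ≥∞ t = t ℚ.≤ a
∞     ≥∞ t = ⊤

IsTropicalRep : ∀ {n} (G : SimpleGraph n) (m : ℕ) → (Fin n → Vec ℚ∞ m) → ℚ → Set
IsTropicalRep {n} G m f t =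
  ℚ.0ℚ ℚ.< t × (∀ (x y : Fin n) → ¬ x ≡ y → Adj G x y ⇔ (f x ⊙ f y) ≥∞ t)

ρT≤ : ∀ {n} → SimpleGraph n → ℕ → Set
ρT≤ {n} G k = ∃ λ (m : ℕ) → m Data.Nat.≤ k ×
  ∃ λ (f : Fin n → Vec ℚ∞ m) → ∃ λ (t : ℚ) → IsTropicalRep G m f t

-- Send every vertex of the i-th partite set to the tropical unit vector e_i
-- (0 in coordinate i, ∞ elsewhere). Then e_i ⊙ e_j is 0 if i = j and ∞
-- otherwise, so any positive threshold detects exactly the pairs lying in
-- different partite sets.
module Submission where

open import Defs
open import Data.Nat using (ℕ)
open import Data.Nat.Properties using (≤-refl)
open import Data.Fin using (Fin; zero; suc)
open import Data.Vec using (Vec; []; _∷_; replicate; _[_]≔_)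
open import Data.Unit using (tt)
open import Data.Product using (_,_)
open import Data.Rational as ℚ using (ℚ; 0ℚ; 1ℚ; _<_)
open import Data.Rational.Properties as ℚ using ()
open import Relation.Nullary using (contradiction)
open import Relation.Binary.PropositionalEquality using (_≡_; _≢_; refl; cong)
open import Function using (_∘_)
open import Function.Bundles using (_⇔_; mk⇔)
import Function.Properties.Equivalence as ⇔

tropicalUnit : ∀ {k} → Fin k → Vec ℚ∞ k
tropicalUnit {k} i = replicate k ∞ [ i ]≔ fin 0ℚ

∞-⊙ˡ : ∀ {m} (v : Vec ℚ∞ m) → replicate m ∞ ⊙ v ≡ ∞
∞-⊙ˡ []      = refl
∞-⊙ˡ (_ ∷ v) = cong (∞ ⊓∞_) (∞-⊙ˡ v)

∞-⊙ʳ : ∀ {m} (v : Vec ℚ∞ m) → v ⊙ replicate m ∞ ≡ ∞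
∞-⊙ʳ []          = refl
∞-⊙ʳ (fin _ ∷ v) = cong (∞ ⊓∞_) (∞-⊙ʳ v)
∞-⊙ʳ (∞ ∷ v)     = cong (∞ ⊓∞_) (∞-⊙ʳ v)

tropicalUnit-⊙-self : ∀ {k} (i : Fin k) → tropicalUnit i ⊙ tropicalUnit i ≡ fin 0ℚ
tropicalUnit-⊙-self {ℕ.suc k} zero = cong (fin 0ℚ ⊓∞_) (∞-⊙ˡ (replicate k ∞))
tropicalUnit-⊙-self (suc i)        = tropicalUnit-⊙-self i

tropicalUnit-⊙-≢ : ∀ {k} {i j : Fin k} → i ≢ j → tropicalUnit i ⊙ tropicalUnit j ≡ ∞
tropicalUnit-⊙-≢ {i = zero}  {zero}  i≢j = contradiction refl i≢j
tropicalUnit-⊙-≢ {i = zero}  {suc j} _   = ∞-⊙ˡ (tropicalUnit j)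
tropicalUnit-⊙-≢ {i = suc i} {zero}  _   = ∞-⊙ʳ (tropicalUnit i)
tropicalUnit-⊙-≢ {i = suc i} {suc j} i≢j = tropicalUnit-⊙-≢ (i≢j ∘ cong suc)

tropicalUnit-⊙-≥∞⇔≢ : ∀ {k} {i j : Fin k} {t : ℚ} → 0ℚ < t →
                      (tropicalUnit i ⊙ tropicalUnit j) ≥∞ t ⇔ i ≢ j
tropicalUnit-⊙-≥∞⇔≢ {i = i} {j} {t} 0<t = mk⇔ ≥t⇒≢ ≢⇒≥t
  where
  ≥t⇒≢ : (tropicalUnit i ⊙ tropicalUnit j) ≥∞ t → i ≢ j
  ≥t⇒≢ ≥t refl rewrite tropicalUnit-⊙-self i = ℚ.<-irrefl refl (ℚ.<-≤-trans 0<t ≥t)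

  ≢⇒≥t : i ≢ j → (tropicalUnit i ⊙ tropicalUnit j) ≥∞ t
  ≢⇒≥t i≢j rewrite tropicalUnit-⊙-≢ i≢j = tt

mainTheorem16 : (n k : ℕ) (G : SimpleGraph n) → IsCompleteMultipartite k G → ρT≤ G k
mainTheorem16 n k G (part , adj⇔) =
  k , ≤-refl , tropicalUnit ∘ part , 1ℚ , 0<1 , λ x y _ →
    ⇔.trans (adj⇔ x y) (⇔.sym (tropicalUnit-⊙-≥∞⇔≢ 0<1))
  where
  0<1 : 0ℚ < 1ℚ
  0<1 = ℚ.positive⁻¹ 1ℚ
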